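{- For $2\le m\le n$, $m+n+1\le \operatorname{rb}([m]\times[n],x_1+x_2=x_3)$.
   Context: $[m]\times[n]=\{(i,j)\in\mathbb{Z}^2:1\le i\le m,1\le j\le n\}$ with componentwise addition. An $r$-coloring is a map $c:[m]\times[n]\to\{1,\dots,r\}$, exact if surjective. A rainbow solution to $x_1+x_2=x_3$ is a triple $\alpha,\beta,\gamma\in[m]\times[n]$ with $\alpha+\beta=\gamma$ and pairwise distinct colors. $\operatorname{rb}([m]\times[n],x_1+x_2=x_3)$ is the smallest $r$ such that every exact $r$-coloring of $[m]\times[n]$ contains a rainbow solution. -}

module Defs where

open import Data.Nat using (ℕ; _+_; _≤_; _<_)
open import Data.Fin using (Fin)
open import Data.Product using (_×_; _,_; Σ; ∃-syntax)
open import Relation.Binary.PropositionalEquality using (_≡_; _≢_)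
open import Relation.Nullary using (¬_)

-- Points of ℤ² restricted to the positive quadrant; the grid [m]×[n].
Point : Set
Point = ℕ × ℕ

InGrid : ℕ → ℕ → Point → Set
InGrid m n (i , j) = (1 ≤ i × i ≤ m) × (1 ≤ j × j ≤ n)

_⊕_ : Point → Point → Point
(a , b) ⊕ (c , d) = (a + c , b + d)

-- An r-coloring: colors {1,…,r} represented by Fin r.
-- Only its values on the grid [m]×[n] are relevant.
Coloring : ℕ → Set
Coloring r = Point → Fin r

Exact : ℕ → ℕ → (r : ℕ) → Coloring r → Set
Exact m n r c = (k : Fin r) → ∃[ p ] (InGrid m n p × c p ≡ k)

HasRainbow : ℕ → ℕ → (r : ℕ) → Coloring r → Set
HasRainbow m n r c =
  ∃[ α ] ∃[ β ] ∃[ γ ]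
    (InGrid m n α × InGrid m n β × InGrid m n γ × (α ⊕ β) ≡ γ
     × c α ≢ c β × c α ≢ c γ × c β ≢ c γ)

RbProp : ℕ → ℕ → ℕ → Set
RbProp m n r = (c : Coloring r) → Exact m n r c → HasRainbow m n r c

IsRb : ℕ → ℕ → ℕ → Set
IsRb m n r = (1 ≤ r × RbProp m n r) × (∀ s → 1 ≤ s → s < r → ¬ RbProp m n s)

{-# OPTIONS --safe #-}
module Submission where

-- Colour the m+n−1 points of the last row and last column with pairwise
-- distinct colours and all interior points (i < m, j < n) with one further
-- colour: this uses m+n colours. In a solution α + β = γ inside the grid both
-- summands are interior, because each is strictly below γ in both
-- coordinates, so α and β have the same colour and nothing is rainbow.
-- Merging colours turns this into an exact r-colouring without rainbow
-- solutions for every 1 ≤ r ≤ m + n.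

open import Defs
open import Data.Nat using (ℕ; zero; suc; _+_; _∸_; _≤_; _<_; _<?_; _≤?_; z≤n; s≤s)
open import Data.Nat.Properties
open import Data.Fin using (Fin; toℕ) renaming (zero to fzero; suc to fsuc)
open import Data.Fin.Properties using (toℕ<n)
open import Data.Product using (_×_; _,_; ∃-syntax)
open import Relation.Binary.PropositionalEquality using (_≡_; refl; sym; trans; cong; cong₂; subst; subst₂)
open import Relation.Nullary using (¬_; yes; no)
open import Data.Empty using (⊥-elim)
open import Function using (_∘_)

Interior : ℕ → ℕ → Point → Set
Interior m n (i , j) = i < m × j < n

<-of-+-pos : ∀ {a b c} → 1 ≤ b → a + b ≤ c → a < c
<-of-+-pos {a} 1≤b a+b≤c = <-≤-trans (m<m+n a 1≤b) a+b≤c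

summand-interior : ∀ {m n α β} → InGrid m n β → InGrid m n (α ⊕ β) →
                   Interior m n α
summand-interior ((1≤b₁ , _) , (1≤b₂ , _)) ((_ , a₁+b₁≤m) , (_ , a₂+b₂≤n)) =
  <-of-+-pos 1≤b₁ a₁+b₁≤m , <-of-+-pos 1≤b₂ a₂+b₂≤n

⊕-comm : ∀ α β → α ⊕ β ≡ β ⊕ α
⊕-comm (a₁ , a₂) (b₁ , b₂) = cong₂ _,_ (+-comm a₁ b₁) (+-comm a₂ b₂)

summands-interior : ∀ {m n α β} → InGrid m n α → InGrid m n β →
                    InGrid m n (α ⊕ β) → Interior m n α × Interior m n β
summands-interior {m} {n} {α} {β} α∈ β∈ γ∈ =
  summand-interior β∈ γ∈ , summand-interior α∈ (subst (InGrid m n) (⊕-comm α β) γ∈)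

monochromatic-interior⇒¬HasRainbow :
  ∀ {m n r} (c : Coloring r) →
  (∀ {p q} → Interior m n p → Interior m n q → c p ≡ c q) →
  ¬ HasRainbow m n r c
monochromatic-interior⇒¬HasRainbow c mono
  (α , β , γ , α∈ , β∈ , γ∈ , refl , cα≢cβ , _)
  with summands-interior α∈ β∈ γ∈
... | α° , β° = cα≢cβ (mono α° β°)

clamp : (t : ℕ) → ℕ → Fin (suc t)
clamp zero    _       = fzero
clamp (suc t) zero    = fzero
clamp (suc t) (suc k) = fsuc (clamp t k)

clamp-toℕ : ∀ t (x : Fin (suc t)) → clamp t (toℕ x) ≡ x
clamp-toℕ zero    fzero    = refl
clamp-toℕ (suc t) fzero    = refl
clamp-toℕ (suc t) (fsuc x) = cong fsuc (clamp-toℕ t x)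

Onto : ℕ → ℕ → ℕ → (Point → ℕ) → Set
Onto m n r g = ∀ k → k < r → ∃[ p ] (InGrid m n p × g p ≡ k)

clamp-exact : ∀ {m n t} (g : Point → ℕ) → Onto m n (suc t) g →
              Exact m n (suc t) (clamp t ∘ g)
clamp-exact {t = t} g onto x with onto (toℕ x) (toℕ<n x)
... | p , p∈ , gp≡x = p , p∈ , trans (cong (clamp t) gp≡x) (clamp-toℕ t x)

boundaryColouring : ℕ → ℕ → Point → ℕ
boundaryColouring m n (i , j) with i <? m | j <? n
... | yes _ | yes _ = 0
... | yes _ | no _  = n + i
... | no _  | _     = j

module _ (m n : ℕ) where

  boundaryColouring-interior : ∀ {p} → Interior m n p → boundaryColouring m n p ≡ 0
  boundaryColouring-interior {i , j} (i<m , j<n) with i <? m | j <? n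
  ... | yes _ | yes _   = refl
  ... | yes _ | no j≮n  = ⊥-elim (j≮n j<n)
  ... | no i≮m | _      = ⊥-elim (i≮m i<m)

  boundaryColouring-lastRow : ∀ j → boundaryColouring m n (m , j) ≡ j
  boundaryColouring-lastRow j with m <? m
  ... | yes m<m = ⊥-elim (<-irrefl refl m<m)
  ... | no _    = refl

  boundaryColouring-lastColumn : ∀ {i} → i < m → boundaryColouring m n (i , n) ≡ n + i
  boundaryColouring-lastColumn {i} i<m with i <? m | n <? n
  ... | no i≮m | _      = ⊥-elim (i≮m i<m)
  ... | yes _  | yes n<n = ⊥-elim (<-irrefl refl n<n)
  ... | yes _  | no _    = refl

  boundaryColouring-onto : 2 ≤ m → 2 ≤ n → Onto m n (m + n) (boundaryColouring m n)
  boundaryColouring-onto 2≤m 2≤n zero _ =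
    (1 , 1) , ((≤-refl , <⇒≤ 2≤m) , (≤-refl , <⇒≤ 2≤n)) ,
    boundaryColouring-interior (2≤m , 2≤n)
  boundaryColouring-onto 2≤m 2≤n (suc k) k<m+n with suc k ≤? n
  ... | yes 1+k≤n = (m , suc k) , ((<⇒≤ 2≤m , ≤-refl) , (s≤s z≤n , 1+k≤n)) ,
                    boundaryColouring-lastRow (suc k)
  ... | no 1+k≰n  = (i , n) , ((0<i , <⇒≤ i<m) , (<⇒≤ 2≤n , ≤-refl)) ,
                    trans (boundaryColouring-lastColumn i<m) n+i≡1+k
    where
      n<1+k : n < suc k
      n<1+k = ≰⇒> 1+k≰n
      i : ℕ
      i = suc k ∸ n
      n+i≡1+k : n + i ≡ suc k
      n+i≡1+k = m+[n∸m]≡n (<⇒≤ n<1+k)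
      0<i : 1 ≤ i
      0<i = m<n⇒0<n∸m n<1+k
      i<m : i < m
      i<m = +-cancelˡ-< n i m (subst₂ _<_ (sym n+i≡1+k) (+-comm m n) k<m+n)

  ¬RbProp-below : 2 ≤ m → 2 ≤ n → ∀ t → suc t ≤ m + n → ¬ RbProp m n (suc t)
  ¬RbProp-below 2≤m 2≤n t t<m+n rb =
    monochromatic-interior⇒¬HasRainbow c interior-monochromatic (rb c exact)
    where
      c : Coloring (suc t)
      c = clamp t ∘ boundaryColouring m n
      exact : Exact m n (suc t) c
      exact = clamp-exact (boundaryColouring m n)
                λ k k≤t → boundaryColouring-onto 2≤m 2≤n k (<-≤-trans k≤t t<m+n)
      interior-monochromatic : ∀ {p q} → Interior m n p → Interior m n q → c p ≡ c q
      interior-monochromatic p° q° =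
        cong (clamp t) (trans (boundaryColouring-interior p°)
                              (sym (boundaryColouring-interior q°)))

lemma2p6 : (m n : ℕ) → 2 ≤ m → m ≤ n →
    (r : ℕ) → IsRb m n r → m + n + 1 ≤ r
lemma2p6 m n 2≤m m≤n zero    ((() , _) , _)
lemma2p6 m n 2≤m m≤n (suc t) ((_ , rb) , _) with suc t ≤? m + n
... | yes t<m+n = ⊥-elim (¬RbProp-below m n 2≤m (≤-trans 2≤m m≤n) t t<m+n rb)
... | no t≮m+n  = subst (_≤ suc t) (+-comm 1 (m + n)) (≰⇒> t≮m+n)
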